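{- Let $I$ be an index set and let $T=\{t_i\}_{i\in I}$ and $T'=\{t'_i\}_{i\in I}$ be $I$-indexed teams. Then $T$ and $T'$ are stutter-equivalent teams if and only if the snapshot traces $\mathsf{sn}(T)$ and $\mathsf{sn}(T')$ are stutter-equivalent traces.
   Context: Here $\mathsf{AP}$ may be an arbitrary set of propositions. A trace is an infinite sequence $t=t(0)t(1)\cdots$ of subsets of the underlying proposition set; a team is a set of traces. Two traces $t,t'$ are stutter-equivalent if there are sequences $0=i_0<i_1<\cdots$ and $0=j_0<j_1<\cdots$ such that for all $k$, $t(i_k)=\cdots=t(i_{k+1}-1)=t'(j_k)=\cdots=t'(j_{k+1}-1)$. A stuttering function of a trace $t$ is a strictly increasing $f:\mathbb N\to\mathbb N$ with $f(0)=0$ and $t(f(k))=\cdots=t(f(k+1)-1)$ for all $k$; a stuttering function of a team is one that is a stuttering function of each of its traces. For $f:\mathbb N\to\mathbb N$, $t[f]=t(f(0))t(f(1))\cdots$ and $T[f]=\{t[f]\mid t\in T\}$. Teams $T,T'$ are stutter-equivalent if there are stuttering functions $f$ of $T$ and $f'$ of $T'$ with $T[f]=T'[f']$. For an $I$-indexed team $T=\{t_i\}_{i\in I}$, the snapshot trace $\mathsf{sn}(T)$ is the trace over the proposition set $\mathsf{AP}\times I$ defined by $(p,i)\in\mathsf{sn}(T)(n)$ iff $p\in t_i(n)$. -}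

module Defs where

open import Level using (0ℓ)
open import Data.Nat using (ℕ; zero; suc; _≤_; _<_)
open import Data.Product using (Σ; _×_; _,_; ∃-syntax)
open import Relation.Unary using (Pred; _≐_)
open import Relation.Binary.PropositionalEquality using (_≡_)

Letter : Set → Set₁
Letter AP = Pred AP 0ℓ

Trace : Set → Set₁
Trace AP = ℕ → Letter AP

IndexedTeam : Set → Set → Set₁
IndexedTeam AP I = I → Trace AP

StrictlyIncreasing : (ℕ → ℕ) → Set
StrictlyIncreasing f = ∀ m n → m < n → f m < f n

StutterEquivTrace : {AP : Set} → Trace AP → Trace AP → Set
StutterEquivTrace t t' =
  Σ (ℕ → ℕ) λ i → Σ (ℕ → ℕ) λ j →
    i 0 ≡ 0 × j 0 ≡ 0 × StrictlyIncreasing i × StrictlyIncreasing j ×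
    (∀ k n m → i k ≤ n → n < i (suc k) → j k ≤ m → m < j (suc k) → t n ≐ t' m)

IsStutteringFunction : {AP : Set} → Trace AP → (ℕ → ℕ) → Set
IsStutteringFunction t f =
  f 0 ≡ 0 × StrictlyIncreasing f ×
  (∀ k n → f k ≤ n → n < f (suc k) → t n ≐ t (f k))

IsTeamStutteringFunction : {AP I : Set} → IndexedTeam AP I → (ℕ → ℕ) → Set
IsTeamStutteringFunction T f = ∀ i → IsStutteringFunction (T i) f

_[_] : {AP : Set} → Trace AP → (ℕ → ℕ) → Trace AP
(t [ f ]) n = t (f n)

_[_]ᵀ : {AP I : Set} → IndexedTeam AP I → (ℕ → ℕ) → IndexedTeam AP I
(T [ f ]ᵀ) i = T i [ f ]

TraceEq : {AP : Set} → Trace AP → Trace AP → Set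
TraceEq t u = ∀ n → t n ≐ u n

TeamEq : {AP I : Set} → IndexedTeam AP I → IndexedTeam AP I → Set
TeamEq T U = ∀ i → TraceEq (T i) (U i)

StutterEquivTeam : {AP I : Set} → IndexedTeam AP I → IndexedTeam AP I → Set
StutterEquivTeam T T' =
  Σ (ℕ → ℕ) λ f → Σ (ℕ → ℕ) λ f' →
    IsTeamStutteringFunction T f × IsTeamStutteringFunction T' f' ×
    TeamEq (T [ f ]ᵀ) (T' [ f' ]ᵀ)

sn : {AP I : Set} → IndexedTeam AP I → Trace (AP × I)
sn T n (p , i) = T i n p

-- A letter of sn(T) is the family of the letters of the traces t_i at the same
-- position, so sn(T) is constant on a block of positions exactly when every t_i
-- is. Hence a stuttering function of the team is a stuttering function of its
-- snapshot trace and vice versa, and T[f] = T'[f'] says sn(T)[f] = sn(T')[f'].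
-- On single traces, stutter-equivalence is the same as having stuttering
-- functions f, f' with t[f] = t'[f'], and the two notions match up.
module Submission where

open import Defs
open import Data.Nat using (ℕ; zero; suc; _≤_; _<_; _⊔_; _<′_; ≤′-reflexive; ≤′-step)
open import Data.Nat.Properties using (≤-refl; n<1+n; <-trans; <⇒<′; m≤n⊔m; m≥n⇒m⊔n≡m)
open import Data.Product using (Σ; _×_; _,_; proj₁; proj₂)
open import Function.Bundles using (_⇔_; mk⇔)
open import Relation.Binary.PropositionalEquality
  using (_≡_; _≗_; refl; sym; trans; cong; subst; subst₂; module ≡-Reasoning)
open import Relation.Unary using (_≐_)
open import Relation.Unary.Properties using (≐-sym; ≐-trans)

private variable
  AP I : Set
  t t' : Trace AP
  T T' : IndexedTeam AP I
  f f' g : ℕ → ℕ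

strictlyIncreasing⇒step : StrictlyIncreasing f → ∀ k → f k < f (suc k)
strictlyIncreasing⇒step si k = si k (suc k) (n<1+n k)

step⇒strictlyIncreasing : (∀ k → f k < f (suc k)) → StrictlyIncreasing f
step⇒strictlyIncreasing {f = f} step m n m<n = go (<⇒<′ m<n)
  where
  go : ∀ {n} → m <′ n → f m < f n
  go (≤′-reflexive refl) = step m
  go (≤′-step m<′n)      = <-trans (go m<′n) (step _)

isStutteringFunction-resp-≗ : f ≗ g → IsStutteringFunction t f → IsStutteringFunction t g
isStutteringFunction-resp-≗ {f = f} {g = g} {t = t} f≗g (f0 , si , block) =
  trans (sym (f≗g 0)) f0 ,
  (λ m n m<n → subst₂ _<_ (f≗g m) (f≗g n) (si m n m<n)) ,
  λ k n gk≤n n<gk+1 → subst (λ x → t n ≐ t x) (f≗g k)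
    (block k n (subst (_≤ n) (sym (f≗g k)) gk≤n) (subst (n <_) (sym (f≗g (suc k))) n<gk+1))

-- For an empty index set every function is a team stuttering function, so a
-- team stuttering function need not start at 0 or increase. The anchor of f
-- does both, and agrees with f whenever f is a stuttering function of some trace.
anchor : (ℕ → ℕ) → ℕ → ℕ
anchor f zero    = 0
anchor f (suc k) = f (suc k) ⊔ suc (anchor f k)

anchor-strictlyIncreasing : StrictlyIncreasing (anchor f)
anchor-strictlyIncreasing {f = f} = step⇒strictlyIncreasing λ k → m≤n⊔m (f (suc k)) (suc (anchor f k))

anchor-≗ : IsStutteringFunction t f → anchor f ≗ f
anchor-≗ (f0 , _ , _) zero = sym f0
anchor-≗ {f = f} sf@(_ , si , _) (suc k) = begin
  f (suc k) ⊔ suc (anchor f k) ≡⟨ cong (λ x → f (suc k) ⊔ suc x) (anchor-≗ sf k) ⟩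
  f (suc k) ⊔ suc (f k)        ≡⟨ m≥n⇒m⊔n≡m (strictlyIncreasing⇒step si k) ⟩
  f (suc k)                    ∎
  where open ≡-Reasoning

anchor-isTeamStutteringFunction :
  IsTeamStutteringFunction T f → IsTeamStutteringFunction T (anchor f)
anchor-isTeamStutteringFunction sf i =
  isStutteringFunction-resp-≗ (λ k → sym (anchor-≗ (sf i) k)) (sf i)

anchor-teamEq : IsTeamStutteringFunction T f → IsTeamStutteringFunction T' f' →
  TeamEq (T [ f ]ᵀ) (T' [ f' ]ᵀ) → TeamEq (T [ anchor f ]ᵀ) (T' [ anchor f' ]ᵀ)
anchor-teamEq {T = T} {T' = T'} sf sf' eq i k =
  subst₂ (λ x y → T i x ≐ T' i y) (sym (anchor-≗ (sf i) k)) (sym (anchor-≗ (sf' i) k)) (eq i k)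

stutteringFunctions⇒stutterEquivTrace :
  IsStutteringFunction t f → IsStutteringFunction t' f' → TraceEq (t [ f ]) (t' [ f' ]) →
  StutterEquivTrace t t'
stutteringFunctions⇒stutterEquivTrace {f = f} {f' = f'} (f0 , si , block) (f0' , si' , block') eq =
  f , f' , f0 , f0' , si , si' ,
  λ k n m fk≤n n<fk+1 f'k≤m m<f'k+1 →
    ≐-trans (block k n fk≤n n<fk+1) (≐-trans (eq k) (≐-sym (block' k m f'k≤m m<f'k+1)))

stutterEquivTrace⇒stutteringFunctions : StutterEquivTrace t t' →
  Σ (ℕ → ℕ) λ f → Σ (ℕ → ℕ) λ f' →
    IsStutteringFunction t f × IsStutteringFunction t' f' × TraceEq (t [ f ]) (t' [ f' ])
stutterEquivTrace⇒stutteringFunctions {t = t} {t' = t'} (i , j , i0 , j0 , si , sj , same) =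
  i , j , (i0 , si , leftBlock) , (j0 , sj , rightBlock) , blockStarts
  where
  blockStarts : TraceEq (t [ i ]) (t' [ j ])
  blockStarts k = same k (i k) (j k) ≤-refl (strictlyIncreasing⇒step si k)
                                     ≤-refl (strictlyIncreasing⇒step sj k)
  leftBlock : ∀ k n → i k ≤ n → n < i (suc k) → t n ≐ t (i k)
  leftBlock k n ik≤n n<ik+1 =
    ≐-trans (same k n (j k) ik≤n n<ik+1 ≤-refl (strictlyIncreasing⇒step sj k))
            (≐-sym (blockStarts k))
  rightBlock : ∀ k m → j k ≤ m → m < j (suc k) → t' m ≐ t' (j k)
  rightBlock k m jk≤m m<jk+1 =
    ≐-trans (≐-sym (same k (i k) m ≤-refl (strictlyIncreasing⇒step si k) jk≤m m<jk+1))
            (blockStarts k)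

sn-≐⁺ : (T T' : IndexedTeam AP I) {n m : ℕ} → (∀ i → T i n ≐ T' i m) → sn T n ≐ sn T' m
sn-≐⁺ _ _ eq = (λ {(_ , i)} → proj₁ (eq i)) , (λ {(_ , i)} → proj₂ (eq i))

sn-≐⁻ : (T T' : IndexedTeam AP I) {n m : ℕ} → sn T n ≐ sn T' m → ∀ i → T i n ≐ T' i m
sn-≐⁻ _ _ (sn⊆ , sn⊇) i = (λ {p} → sn⊆ {p , i}) , (λ {p} → sn⊇ {p , i})

isTeamStutteringFunction⇒sn : f 0 ≡ 0 → StrictlyIncreasing f →
  IsTeamStutteringFunction T f → IsStutteringFunction (sn T) f
isTeamStutteringFunction⇒sn {T = T} f0 si sf =
  f0 , si , λ k n fk≤n n<fk+1 → sn-≐⁺ T T λ i → proj₂ (proj₂ (sf i)) k n fk≤n n<fk+1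

sn⇒isTeamStutteringFunction : IsStutteringFunction (sn T) f → IsTeamStutteringFunction T f
sn⇒isTeamStutteringFunction {T = T} (f0 , si , block) i =
  f0 , si , λ k n fk≤n n<fk+1 → sn-≐⁻ T T (block k n fk≤n n<fk+1) i

teamEq⇒sn : TeamEq (T [ f ]ᵀ) (T' [ f' ]ᵀ) → TraceEq (sn T [ f ]) (sn T' [ f' ])
teamEq⇒sn {T = T} {T' = T'} eq n = sn-≐⁺ T T' λ i → eq i n

sn⇒teamEq : TraceEq (sn T [ f ]) (sn T' [ f' ]) → TeamEq (T [ f ]ᵀ) (T' [ f' ]ᵀ)
sn⇒teamEq {T = T} {T' = T'} eq i n = sn-≐⁻ T T' (eq n) i

proposition22 : {AP I : Set} (T T' : IndexedTeam AP I) →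
    StutterEquivTeam T T' ⇔ StutterEquivTrace (sn T) (sn T')
proposition22 T T' = mk⇔ to from
  where
  to : StutterEquivTeam T T' → StutterEquivTrace (sn T) (sn T')
  to (f , f' , sf , sf' , eq) = stutteringFunctions⇒stutterEquivTrace
    (isTeamStutteringFunction⇒sn refl anchor-strictlyIncreasing (anchor-isTeamStutteringFunction sf))
    (isTeamStutteringFunction⇒sn refl anchor-strictlyIncreasing (anchor-isTeamStutteringFunction sf'))
    (teamEq⇒sn {T = T} {T' = T'} (anchor-teamEq sf sf' eq))

  from : StutterEquivTrace (sn T) (sn T') → StutterEquivTeam T T'
  from equiv with stutterEquivTrace⇒stutteringFunctions equiv
  ... | f , f' , sf , sf' , eq =
    f , f' , sn⇒isTeamStutteringFunction sf , sn⇒isTeamStutteringFunction sf' , sn⇒teamEq {T = T} {T' = T'} eq
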